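{- Let $k,\ell$ be positive integers with $(k,\ell)\neq(2,1)$. For $i\in[k]=\{0,\ldots,k-1\}$ let $S_i^k$ be the set of vertices of $ST^\ell_k$ whose first entry equals $i$. Then $\{S_i^k : i\in[k]\}$ is a partition of $V(ST^\ell_k)$ into $k$ E$^\ell$-sets.
   Context: For integers $k\ge 1$, $\ell\ge 1$, $ST^\ell_k$ has as vertices all strings $v_0\cdots v_{k\ell-1}$ over $[k]$ in which each symbol occurs exactly $\ell$ times; $v,w$ are adjacent iff $w$ arises from $v$ by swapping $v_0$ with some $v_j$ ($1\le j\le k\ell-1$) with $v_j\neq v_0$. A set $S\subseteq V(G)$ is an E$^\ell$-set if each $v\notin S$ has exactly $\ell$ neighbors $v^0,\ldots,v^{\ell-1}$ in $S$ and, when $\ell>1$, $v$ is the only vertex of $G$ adjacent to all of them. -}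

module Defs where

open import Data.Nat using (ℕ; zero; suc; _*_; _<_)
open import Data.Fin using (Fin; toℕ)
open import Data.Vec using (Vec; lookup; toList; _[_]≔_)
open import Data.Vec.Membership.Propositional using (_∈_)
open import Data.List using (head)
open import Data.Maybe using (just)
open import Data.Product using (Σ; _×_)
open import Relation.Binary.PropositionalEquality using (_≡_; _≢_)
open import Relation.Nullary using (¬_)

occ : {k n : ℕ} → Fin k → Vec (Fin k) n → ℕ
occ i Vec.[] = 0
occ i (x Vec.∷ v) with toℕ x Data.Nat.≟ toℕ i
... | Relation.Nullary.yes _ = suc (occ i v)
... | Relation.Nullary.no _ = occ i v

Str : ℕ → ℕ → Set
Str k ℓ = Vec (Fin k) (k * ℓ)

-- v is a vertex of ST^ℓ_k: each symbol occurs exactly ℓ times.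
IsVertex : (k ℓ : ℕ) → Str k ℓ → Set
IsVertex k ℓ v = ∀ (i : Fin k) → occ i v ≡ ℓ

Adj : (k ℓ : ℕ) → Str k ℓ → Str k ℓ → Set
Adj k ℓ v w =
  IsVertex k ℓ v × IsVertex k ℓ w ×
  Σ (Fin (k * ℓ)) λ z → Σ (Fin (k * ℓ)) λ j →
    (toℕ z ≡ 0) × (toℕ j ≢ 0) × (lookup v j ≢ lookup v z) ×
    (w ≡ ((v [ z ]≔ lookup v j) [ j ]≔ lookup v z))

IsEℓSet : {V : Set} (InV : V → Set) (A : V → V → Set) (ℓ : ℕ) (S : V → Set) → Set
IsEℓSet {V} InV A ℓ S =
  ∀ (v : V) → InV v → ¬ S v →
    Σ (Vec V ℓ) λ ns →
      (∀ (p q : Fin ℓ) → lookup ns p ≡ lookup ns q → p ≡ q) ×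
      (∀ x → x ∈ ns → InV x × S x × A v x) ×
      (∀ u → InV u → S u → A v u → u ∈ ns) ×
      (1 < ℓ → ∀ u → InV u → (∀ x → x ∈ ns → A u x) → u ≡ v)

S : (k ℓ : ℕ) → Fin k → Str k ℓ → Set
S k ℓ i v = head (toList v) ≡ just i

{-# OPTIONS --safe #-}
module Submission where

-- A string outside S_i is a ∷ v with a ≠ i. Its neighbours in S_i are exactly the strings
-- obtained by swapping a with an occurrence of i in v; there are ℓ such occurrences, and
-- distinct occurrences give distinct neighbours. A string adjacent to two of these
-- neighbours arises from each of them by a further swap of the head, and the symbols at the
-- two occurrences force that swap to undo the first one, so the string is a ∷ v itself.
-- Swaps preserve symbol counts, so every S_i is reached from the sorted string
-- 0^ℓ 1^ℓ ⋯ (k-1)^ℓ in at most one step.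

open import Defs
open import Data.Fin using (Fin; zero; suc; toℕ; _≟_)
open import Data.Fin.Properties using (toℕ-injective; suc-injective)
open import Data.Maybe using (just)
open import Data.Maybe.Properties using (just-injective)
open import Data.Nat as ℕ using (ℕ; zero; suc; _+_; _*_; _<_; _≤_; s≤s)
open import Data.Nat.Properties using (+-identityʳ; +-commutativeSemigroup)
open import Algebra.Properties.CommutativeSemigroup +-commutativeSemigroup using (x∙yz≈y∙xz)
open import Data.List using (head)
open import Data.Product using (Σ; ∃; ∃₂; _×_; _,_; proj₁; proj₂)
open import Data.Vec using (Vec; []; _∷_; lookup; toList; _[_]≔_; map; replicate; _++_)
open import Data.Vec.Properties using (lookup∘update; lookup∘update′; []≔-idempotent; []≔-lookup; lookup-map; ∷-injective)
open import Data.Vec.Membership.Propositional using (_∈_; find)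
open import Data.Vec.Membership.Propositional.Properties using (∈-map⁺)
open import Data.Vec.Relation.Unary.All as All using (All; []; _∷_)
import Data.Vec.Relation.Unary.All.Properties as All
open import Data.Vec.Relation.Unary.Any using (here; there)
import Data.Vec.Relation.Unary.Any.Properties as Any
open import Data.Vec.Relation.Unary.Unique.Propositional using (Unique; []; _∷_)
import Data.Vec.Relation.Unary.Unique.Propositional.Properties as Unique
open import Function using (_∘_)
open import Relation.Binary.PropositionalEquality
open import Relation.Nullary using (¬_; yes; no; contradiction)

private variable
  A : Set
  k m n ℓ : ℕ

swapHead : A → Vec A n → Fin n → Vec A (suc n)
swapHead a v j = lookup v j ∷ (v [ j ]≔ a)

module _ {a b : A} {v u : Vec A n} where

  swapHead-injective : ∀ {p} → swapHead a v p ≡ swapHead b u p → a ∷ v ≡ b ∷ u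
  swapHead-injective {p} eq = cong₂ _∷_ a≡b v≡u
    where
    heads : lookup v p ≡ lookup u p
    heads = proj₁ (∷-injective eq)
    tails : v [ p ]≔ a ≡ u [ p ]≔ b
    tails = proj₂ (∷-injective eq)
    a≡b : a ≡ b
    a≡b = begin
      a                        ≡⟨ lookup∘update p v a ⟨
      lookup (v [ p ]≔ a) p    ≡⟨ cong (λ w → lookup w p) tails ⟩
      lookup (u [ p ]≔ b) p    ≡⟨ lookup∘update p u b ⟩
      b                        ∎
      where open ≡-Reasoning
    v≡u : v ≡ u
    v≡u = begin
      v                                   ≡⟨ []≔-lookup v p ⟨
      v [ p ]≔ lookup v p                 ≡⟨ []≔-idempotent v p ⟨
      (v [ p ]≔ a) [ p ]≔ lookup v p      ≡⟨ cong₂ (λ w x → w [ p ]≔ x) tails heads ⟩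
      (u [ p ]≔ b) [ p ]≔ lookup u p      ≡⟨ []≔-idempotent u p ⟩
      u [ p ]≔ lookup u p                 ≡⟨ []≔-lookup u p ⟩
      u                                   ∎
      where open ≡-Reasoning

  swapHead-≡⇒lookup≡head : ∀ {p m} → m ≢ p → swapHead a v p ≡ swapHead b u m → lookup u p ≡ a
  swapHead-≡⇒lookup≡head {p} {m} m≢p eq = begin
    lookup u p               ≡⟨ lookup∘update′ (m≢p ∘ sym) u b ⟨
    lookup (u [ m ]≔ b) p    ≡⟨ cong (λ w → lookup w p) (proj₂ (∷-injective eq)) ⟨
    lookup (v [ p ]≔ a) p    ≡⟨ lookup∘update p v a ⟩
    a                        ∎
    where open ≡-Reasoning

  swapHead-≡⇒lookup≡lookup : ∀ {p q m} → p ≢ q → lookup v p ≡ lookup v q →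
    swapHead a v q ≡ swapHead b u m → lookup u p ≡ lookup v p
  swapHead-≡⇒lookup≡lookup {p} {q} {m} p≢q vp≡vq eq with p ≟ m
  ... | yes refl = trans (sym (proj₁ (∷-injective eq))) (sym vp≡vq)
  ... | no p≢m = begin
    lookup u p               ≡⟨ lookup∘update′ p≢m u b ⟨
    lookup (u [ m ]≔ b) p    ≡⟨ cong (λ w → lookup w p) (proj₂ (∷-injective eq)) ⟨
    lookup (v [ q ]≔ a) p    ≡⟨ lookup∘update′ p≢q v a ⟩
    lookup v p               ∎
    where open ≡-Reasoning

  -- If m ≠ p, the first equation puts a at position p of u, while the second
  -- leaves the symbol v_p ≠ a there.
  swapHead-common-neighbour : ∀ {p q m m′} → p ≢ q → lookup v p ≡ lookup v q → lookup v p ≢ a →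
    swapHead a v p ≡ swapHead b u m → swapHead a v q ≡ swapHead b u m′ → a ∷ v ≡ b ∷ u
  swapHead-common-neighbour {p} {m = m} p≢q vp≡vq vp≢a eq₁ eq₂ with m ≟ p
  ... | yes refl = swapHead-injective eq₁
  ... | no m≢p = contradiction
    (trans (sym (swapHead-≡⇒lookup≡lookup p≢q vp≡vq eq₂)) (swapHead-≡⇒lookup≡head m≢p eq₁)) vp≢a

swapHead-injectiveʳ : {a : A} {v : Vec A n} {j j′ : Fin n} → lookup v j ≢ a →
  swapHead a v j ≡ swapHead a v j′ → j ≡ j′
swapHead-injectiveʳ {j = j} {j′} vj≢a eq with j′ ≟ j
... | yes j′≡j = sym j′≡j
... | no j′≢j = contradiction (swapHead-≡⇒lookup≡head j′≢j eq) vj≢a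

occ-∷ : (i x : Fin k) (v : Vec (Fin k) n) → occ i (x ∷ v) ≡ occ i (x ∷ []) + occ i v
occ-∷ i x v with toℕ x ℕ.≟ toℕ i
... | yes _ = refl
... | no _ = refl

occ-∷-≡ : (i : Fin k) (v : Vec (Fin k) n) → occ i (i ∷ v) ≡ suc (occ i v)
occ-∷-≡ i v with toℕ i ℕ.≟ toℕ i
... | yes _ = refl
... | no i≢i = contradiction refl i≢i

occ-∷-≢ : {i x : Fin k} (v : Vec (Fin k) n) → x ≢ i → occ i (x ∷ v) ≡ occ i v
occ-∷-≢ {i = i} {x} v x≢i with toℕ x ℕ.≟ toℕ i
... | yes x≡i = contradiction (toℕ-injective x≡i) x≢i
... | no _ = refl

occ-∷-cong : (i x : Fin k) {v w : Vec (Fin k) n} →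
  occ i v ≡ occ i w → occ i (x ∷ v) ≡ occ i (x ∷ w)
occ-∷-cong i x eq with toℕ x ℕ.≟ toℕ i
... | yes _ = cong suc eq
... | no _ = eq

occ-∷-comm : (i x y : Fin k) (v : Vec (Fin k) n) → occ i (x ∷ y ∷ v) ≡ occ i (y ∷ x ∷ v)
occ-∷-comm i x y v = begin
  occ i (x ∷ y ∷ v)                          ≡⟨ occ-∷ i x (y ∷ v) ⟩
  occ i (x ∷ []) + occ i (y ∷ v)             ≡⟨ cong (occ i (x ∷ []) +_) (occ-∷ i y v) ⟩
  occ i (x ∷ []) + (occ i (y ∷ []) + occ i v) ≡⟨ x∙yz≈y∙xz (occ i (x ∷ [])) (occ i (y ∷ [])) (occ i v) ⟩
  occ i (y ∷ []) + (occ i (x ∷ []) + occ i v) ≡⟨ cong (occ i (y ∷ []) +_) (occ-∷ i x v) ⟨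
  occ i (y ∷ []) + occ i (x ∷ v)             ≡⟨ occ-∷ i y (x ∷ v) ⟨
  occ i (y ∷ x ∷ v)                          ∎
  where open ≡-Reasoning

occ-swapHead : (i a : Fin k) (v : Vec (Fin k) n) (j : Fin n) → occ i (swapHead a v j) ≡ occ i (a ∷ v)
occ-swapHead i a (x ∷ v) zero = occ-∷-comm i x a v
occ-swapHead i a (x ∷ v) (suc j) = begin
  occ i (lookup v j ∷ x ∷ (v [ j ]≔ a))    ≡⟨ occ-∷-comm i (lookup v j) x _ ⟩
  occ i (x ∷ swapHead a v j)               ≡⟨ occ-∷-cong i x (occ-swapHead i a v j) ⟩
  occ i (x ∷ a ∷ v)                        ≡⟨ occ-∷-comm i x a v ⟩
  occ i (a ∷ x ∷ v)                        ∎
  where open ≡-Reasoning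

occ≡suc⇒∃lookup : {i : Fin k} (v : Vec (Fin k) n) → occ i v ≡ suc m → ∃ λ j → lookup v j ≡ i
occ≡suc⇒∃lookup {i = i} (x ∷ v) eq with toℕ x ℕ.≟ toℕ i
... | yes x≡i = zero , toℕ-injective x≡i
... | no _ = let j , vj≡i = occ≡suc⇒∃lookup v eq in suc j , vj≡i

occ-++ : (i : Fin k) (xs : Vec (Fin k) m) (ys : Vec (Fin k) n) →
  occ i (xs ++ ys) ≡ occ i xs + occ i ys
occ-++ i [] ys = refl
occ-++ i (x ∷ xs) ys with toℕ x ℕ.≟ toℕ i
... | yes _ = cong suc (occ-++ i xs ys)
... | no _ = occ-++ i xs ys

occ-replicate-≡ : (i : Fin k) (m : ℕ) → occ i (replicate m i) ≡ m
occ-replicate-≡ i zero = refl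
occ-replicate-≡ i (suc m) = trans (occ-∷-≡ i _) (cong suc (occ-replicate-≡ i m))

occ-replicate-≢ : {i x : Fin k} (m : ℕ) → x ≢ i → occ i (replicate m x) ≡ 0
occ-replicate-≢ zero x≢i = refl
occ-replicate-≢ (suc m) x≢i = trans (occ-∷-≢ _ x≢i) (occ-replicate-≢ m x≢i)

occ-zero-map-suc : (v : Vec (Fin k) n) → occ zero (map suc v) ≡ 0
occ-zero-map-suc [] = refl
occ-zero-map-suc (x ∷ v) = trans (occ-∷-≢ {x = suc x} (map suc v) λ ()) (occ-zero-map-suc v)

occ-suc-map-suc : (i : Fin k) (v : Vec (Fin k) n) → occ (suc i) (map suc v) ≡ occ i v
occ-suc-map-suc i [] = refl
occ-suc-map-suc i (x ∷ v) with x ≟ i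
... | yes refl = begin
  occ (suc x) (suc x ∷ map suc v)    ≡⟨ occ-∷-≡ (suc x) (map suc v) ⟩
  suc (occ (suc x) (map suc v))      ≡⟨ cong suc (occ-suc-map-suc x v) ⟩
  suc (occ x v)                      ≡⟨ occ-∷-≡ x v ⟨
  occ x (x ∷ v)                      ∎
  where open ≡-Reasoning
... | no x≢i = begin
  occ (suc i) (suc x ∷ map suc v)    ≡⟨ occ-∷-≢ (map suc v) (x≢i ∘ suc-injective) ⟩
  occ (suc i) (map suc v)            ≡⟨ occ-suc-map-suc i v ⟩
  occ i v                            ≡⟨ occ-∷-≢ v x≢i ⟨
  occ i (x ∷ v)                      ∎
  where open ≡-Reasoning

Balanced : ℕ → Vec (Fin k) n → Set
Balanced {k} ℓ v = (i : Fin k) → occ i v ≡ ℓ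

sorted : (k ℓ : ℕ) → Vec (Fin k) (k * ℓ)
sorted zero ℓ = []
sorted (suc k) ℓ = replicate ℓ zero ++ map suc (sorted k ℓ)

sorted-balanced : (k ℓ : ℕ) → Balanced ℓ (sorted k ℓ)
sorted-balanced (suc k) ℓ zero = begin
  occ zero (replicate ℓ zero ++ map suc s)            ≡⟨ occ-++ zero (replicate ℓ zero) (map suc s) ⟩
  occ zero (replicate ℓ zero) + occ zero (map suc s)  ≡⟨ cong₂ _+_ (occ-replicate-≡ zero ℓ) (occ-zero-map-suc s) ⟩
  ℓ + 0                                               ≡⟨ +-identityʳ ℓ ⟩
  ℓ                                                   ∎
  where
  open ≡-Reasoning
  s : Vec (Fin k) (k * ℓ)
  s = sorted k ℓ
sorted-balanced (suc k) ℓ (suc i) = begin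
  occ (suc i) (replicate ℓ zero ++ map suc s)               ≡⟨ occ-++ (suc i) (replicate ℓ zero) (map suc s) ⟩
  occ (suc i) (replicate ℓ zero) + occ (suc i) (map suc s)  ≡⟨ cong₂ _+_ (occ-replicate-≢ ℓ λ ()) (occ-suc-map-suc i s) ⟩
  occ i s                                                   ≡⟨ sorted-balanced k ℓ i ⟩
  ℓ                                                         ∎
  where
  open ≡-Reasoning
  s : Vec (Fin k) (k * ℓ)
  s = sorted k ℓ

swapHead-balanced : (a : Fin k) (v : Vec (Fin k) n) (j : Fin n) →
  Balanced ℓ (a ∷ v) → Balanced ℓ (swapHead a v j)
swapHead-balanced a v j balanced i = trans (occ-swapHead i a v j) (balanced i)

positions : (i : Fin k) (v : Vec (Fin k) n) → Vec (Fin n) (occ i v)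
positions i [] = []
positions i (x ∷ v) with toℕ x ℕ.≟ toℕ i
... | yes _ = zero ∷ map suc (positions i v)
... | no _ = map suc (positions i v)

positions-unique : (i : Fin k) (v : Vec (Fin k) n) → Unique (positions i v)
positions-unique i [] = []
positions-unique i (x ∷ v) with toℕ x ℕ.≟ toℕ i
... | yes _ = All.map⁺ (All.universal (λ _ ()) (positions i v))
            ∷ Unique.map⁺ suc-injective (positions-unique i v)
... | no _ = Unique.map⁺ suc-injective (positions-unique i v)

positions-sound : (i : Fin k) (v : Vec (Fin k) n) → All (λ j → lookup v j ≡ i) (positions i v)
positions-sound i [] = []
positions-sound i (x ∷ v) with toℕ x ℕ.≟ toℕ i
... | yes x≡i = toℕ-injective x≡i ∷ All.map⁺ (positions-sound i v)
... | no _ = All.map⁺ (positions-sound i v)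

∈-positions⁺ : (i : Fin k) (v : Vec (Fin k) n) {j : Fin n} → lookup v j ≡ i → j ∈ positions i v
∈-positions⁺ i (x ∷ v) {j} vj≡i with toℕ x ℕ.≟ toℕ i
∈-positions⁺ i (x ∷ v) {zero} x≡i | yes _ = here refl
∈-positions⁺ i (x ∷ v) {suc j} vj≡i | yes _ = there (∈-map⁺ suc (∈-positions⁺ i v vj≡i))
∈-positions⁺ i (x ∷ v) {zero} x≡i | no x≢i = contradiction (cong toℕ x≡i) x≢i
∈-positions⁺ i (x ∷ v) {suc j} vj≡i | no _ = ∈-map⁺ suc (∈-positions⁺ i v vj≡i)

-- Adj and S of Defs at an arbitrary string length, so that strings can be
-- matched as a ∷ v; at length k * ℓ they unfold to Adj k ℓ and S k ℓ.
Adjacent : ℕ → Vec (Fin k) n → Vec (Fin k) n → Set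
Adjacent {n = n} ℓ v w =
  Balanced ℓ v × Balanced ℓ w ×
  Σ (Fin n) λ z → Σ (Fin n) λ j →
    (toℕ z ≡ 0) × (toℕ j ≢ 0) × (lookup v j ≢ lookup v z) ×
    (w ≡ ((v [ z ]≔ lookup v j) [ j ]≔ lookup v z))

HeadIs : Fin k → Vec (Fin k) n → Set
HeadIs i v = head (toList v) ≡ just i

swapHead-adjacent : {a : Fin k} {v : Vec (Fin k) n} {j : Fin n} → Balanced ℓ (a ∷ v) → lookup v j ≢ a →
  Adjacent ℓ (a ∷ v) (swapHead a v j)
swapHead-adjacent {a = a} {v} {j} balanced vj≢a =
  balanced , swapHead-balanced a v j balanced , zero , suc j , refl , (λ ()) , vj≢a , refl

adjacent⇒swapHead : {a : Fin k} {v : Vec (Fin k) n} {w : Vec (Fin k) (suc n)} → Adjacent ℓ (a ∷ v) w →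
  ∃ λ j → lookup v j ≢ a × w ≡ swapHead a v j
adjacent⇒swapHead (_ , _ , zero , zero , _ , j≢0 , _) = contradiction refl j≢0
adjacent⇒swapHead (_ , _ , zero , suc j , _ , _ , vj≢a , w≡swap) = j , vj≢a , w≡swap

balanced⇒headIs : (i : Fin k) (v : Vec (Fin k) n) → Balanced (suc ℓ) v →
  Σ (Vec (Fin k) n) λ w → Balanced (suc ℓ) w × HeadIs i w
balanced⇒headIs i v balanced with occ≡suc⇒∃lookup v (balanced i)
balanced⇒headIs i (a ∷ v) balanced | zero , a≡i = a ∷ v , balanced , cong just a≡i
balanced⇒headIs i (a ∷ v) balanced | suc j , vj≡i =
  swapHead a v j , swapHead-balanced a v j balanced , cong just vj≡i

two-distinct : {xs : Vec A m} → Unique xs → 1 < m → ∃₂ λ x y → x ∈ xs × y ∈ xs × x ≢ y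
two-distinct {xs = x ∷ y ∷ _} ((x≢y ∷ _) ∷ _) _ = x , y , here refl , there (here refl) , x≢y
two-distinct {xs = _ ∷ []} _ (s≤s ())

EℓNeighbours : {V : Set} → (V → Set) → (V → V → Set) → (V → Set) → V → ℕ → Set
EℓNeighbours {V} InV A S v m =
  Σ (Vec V m) λ ns →
    (∀ (p q : Fin m) → lookup ns p ≡ lookup ns q → p ≡ q) ×
    (∀ x → x ∈ ns → InV x × S x × A v x) ×
    (∀ u → InV u → S u → A v u → u ∈ ns) ×
    (1 < m → ∀ u → InV u → (∀ x → x ∈ ns → A u x) → u ≡ v)

headIs-eℓNeighbours : (i a : Fin k) (v : Vec (Fin k) n) → Balanced ℓ (a ∷ v) → a ≢ i →
  EℓNeighbours (Balanced ℓ) (Adjacent ℓ) (HeadIs i) (a ∷ v) (occ i v)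
headIs-eℓNeighbours {k = k} {n = n} {ℓ = ℓ} i a v balanced a≢i = ns , distinct , sound , complete , common
  where
  ps : Vec (Fin n) (occ i v)
  ps = positions i v
  ns : Vec (Vec (Fin k) (suc n)) (occ i v)
  ns = map (swapHead a v) ps

  ≡i⇒≢a : ∀ {j} → lookup v j ≡ i → lookup v j ≢ a
  ≡i⇒≢a vj≡i vj≡a = a≢i (trans (sym vj≡a) vj≡i)

  ∈ps⇒≡i : ∀ {j} → j ∈ ps → lookup v j ≡ i
  ∈ps⇒≡i = All.lookup (positions-sound i v)

  distinct : ∀ p q → lookup ns p ≡ lookup ns q → p ≡ q
  distinct p q eq = Unique.lookup-injective (positions-unique i v) p q
    (swapHead-injectiveʳ (≡i⇒≢a (All.lookup⁺ (positions-sound i v) p))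
      (trans (sym (lookup-map p (swapHead a v) ps)) (trans eq (lookup-map q (swapHead a v) ps))))

  sound : ∀ x → x ∈ ns → Balanced ℓ x × HeadIs i x × Adjacent ℓ (a ∷ v) x
  sound x x∈ns with find (Any.map⁻ x∈ns)
  ... | j , j∈ps , refl =
    swapHead-balanced a v j balanced , cong just (∈ps⇒≡i j∈ps) ,
    swapHead-adjacent balanced (≡i⇒≢a (∈ps⇒≡i j∈ps))

  complete : ∀ w → Balanced ℓ w → HeadIs i w → Adjacent ℓ (a ∷ v) w → w ∈ ns
  complete w _ w₀≡i adjacent with adjacent⇒swapHead adjacent
  ... | j , _ , refl = ∈-map⁺ (swapHead a v) (∈-positions⁺ i v (just-injective w₀≡i))

  common : 1 < occ i v → ∀ u → Balanced ℓ u → (∀ x → x ∈ ns → Adjacent ℓ u x) → u ≡ a ∷ v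
  common 1<occ (b ∷ u) _ adjacent
    with p , q , p∈ps , q∈ps , p≢q ← two-distinct (positions-unique i v) 1<occ
    with m , _ , eq₁ ← adjacent⇒swapHead (adjacent _ (∈-map⁺ (swapHead a v) p∈ps))
    with m′ , _ , eq₂ ← adjacent⇒swapHead (adjacent _ (∈-map⁺ (swapHead a v) q∈ps)) =
    sym (swapHead-common-neighbour p≢q (trans (∈ps⇒≡i p∈ps) (sym (∈ps⇒≡i q∈ps)))
          (≡i⇒≢a (∈ps⇒≡i p∈ps)) eq₁ eq₂)

headIs-isEℓSet : (i : Fin k) → IsEℓSet (Balanced {n = suc n} ℓ) (Adjacent ℓ) ℓ (HeadIs i)
headIs-isEℓSet {ℓ = ℓ} i (a ∷ v) balanced a∉Sᵢ =
  subst (EℓNeighbours (Balanced ℓ) (Adjacent ℓ) (HeadIs i) (a ∷ v)) occ≡ℓ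
    (headIs-eℓNeighbours i a v balanced a≢i)
  where
  a≢i : a ≢ i
  a≢i = a∉Sᵢ ∘ cong just
  occ≡ℓ : occ i v ≡ ℓ
  occ≡ℓ = trans (sym (occ-∷-≢ v a≢i)) (balanced i)

corollary3 : (k ℓ : ℕ) → 1 ≤ k → 1 ≤ ℓ → ¬ (k ≡ 2 × ℓ ≡ 1) →
    ((i : Fin k) → Σ (Str k ℓ) λ v → IsVertex k ℓ v × S k ℓ i v) ×
    ((v : Str k ℓ) → IsVertex k ℓ v → Σ (Fin k) λ i → S k ℓ i v) ×
    ((i j : Fin k) (v : Str k ℓ) → IsVertex k ℓ v → S k ℓ i v → S k ℓ j v → i ≡ j) ×
    ((i : Fin k) → IsEℓSet (IsVertex k ℓ) (Adj k ℓ) ℓ (S k ℓ i))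
corollary3 (suc k) (suc ℓ) _ _ _ =
  (λ i → balanced⇒headIs i (sorted (suc k) (suc ℓ)) (sorted-balanced (suc k) (suc ℓ))) ,
  (λ { (a ∷ _) _ → a , refl }) ,
  (λ _ _ _ _ v∈Sᵢ v∈Sⱼ → just-injective (trans (sym v∈Sᵢ) v∈Sⱼ)) ,
  headIs-isEℓSet
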